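{- Let $\mathcal{M}$ be a nontrivial graph matroid family with dimensionality $d$ and threshold $t$. Let $G=G_1\cup G_2$, where $G_1$ and $G_2$ are graphs with at least $t$ vertices in common. If $G_1$ and $G_2$ are both $\mathcal{M}$-rigid, then so is $G$.
   Context: All graphs are finite and simple. A graph matroid family $\mathcal{M}$ assigns to every graph $G$ a matroid $\mathcal{M}(G)$ on $E(G)$ such that (i) every graph isomorphism $\varphi:V(G)\to V(H)$ induces, via $uv\mapsto\varphi(u)\varphi(v)$, an isomorphism $\mathcal{M}(G)\to\mathcal{M}(H)$, and (ii) for every subgraph $H$ of $G$, $\mathcal{M}(H)$ is the restriction of $\mathcal{M}(G)$ to $E(H)$. $r(G)$ is the rank of $\mathcal{M}(G)$. $G$ is $\mathcal{M}$-independent if $r(G)=|E(G)|$; $G$ is an $\mathcal{M}$-circuit if it is not $\mathcal{M}$-independent but $G-e$ is $\mathcal{M}$-independent for every $e\in E(G)$; $G$ is $\mathcal{M}$-rigid if $r(G)=r(K_{V(G)})$, where $K_V$ is the complete graph on $V$. $\mathcal{M}$ is trivial if every graph is $\mathcal{M}$-independent. For nontrivial $\mathcal{M}$, the dimensionality is $d=\min\{d': \text{there is an } \mathcal{M}\text{ -circuit with minimum degree } d'+1\}$ and the threshold is $t=\min\{|V(C)|-1: C \text{ an } \mathcal{M}\text{ -circuit with minimum degree } d+1\}$. -}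

module Defs where

open import Data.Nat using (ℕ; zero; suc; _+_; _∸_; _≤_; _<ᵇ_)
open import Data.Fin using (Fin; toℕ; _≟_)
import Data.Fin as F
open import Data.Bool using (Bool; true; false; _∧_; _∨_; not; if_then_else_)
open import Data.Bool.Properties using (∧-comm; ∨-comm; ∧-assoc)
open import Data.Product using (Σ; ∃; _×_; _,_; proj₁)
open import Relation.Nullary using (¬_)
import Relation.Nullary
import Data.Empty
open import Relation.Nullary.Decidable using (⌊_⌋)
open import Relation.Binary.PropositionalEquality using (_≡_; refl; sym; trans; cong; cong₂)

-- A graph of "universe size" n has its vertex set
-- a subset of Fin n (given by a Boolean characteristic function) and its
-- edges given by a symmetric, irreflexive Boolean adjacency relation whose
-- edges lie inside the vertex set.  Every finite simple graph is
-- isomorphic to such a graph for some n.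

EdgeSet : ℕ → Set
EdgeSet n = Fin n → Fin n → Bool

record Graph (n : ℕ) : Set where
  field
    V      : Fin n → Bool
    E      : EdgeSet n
    E-sym  : ∀ u v → E u v ≡ E v u
    E-irr  : ∀ u → E u u ≡ false
    E-V    : ∀ u v → E u v ≡ true → V u ≡ true
open Graph public

countB : ∀ {n} → (Fin n → Bool) → ℕ
countB {zero}  f = 0
countB {suc n} f = (if f F.zero then 1 else 0) + countB (λ i → f (F.suc i))

∣V∣ : ∀ {n} → Graph n → ℕ
∣V∣ G = countB (V G)

sumF : ∀ {n} → (Fin n → ℕ) → ℕ
sumF {zero}  f = 0
sumF {suc n} f = f F.zero + sumF (λ i → f (F.suc i))

∣_∣ₑ : ∀ {n} → EdgeSet n → ℕ
∣ X ∣ₑ = sumF (λ u → countB (λ v → (toℕ u <ᵇ toℕ v) ∧ X u v))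

_==_ : ∀ {n} → Fin n → Fin n → Bool
a == b = ⌊ a ≟ b ⌋

-- X is a set of edges of G: X ⊆ E(G) (and X is symmetric, i.e. really a set
-- of unordered pairs)
_⊆E_ : ∀ {n} → EdgeSet n → Graph n → Set
X ⊆E G = (∀ u v → X u v ≡ true → E G u v ≡ true) × (∀ u v → X u v ≡ X v u)

_⊆_ : ∀ {n} → EdgeSet n → EdgeSet n → Set
X ⊆ Y = ∀ u v → X u v ≡ true → Y u v ≡ true

_∪ₑ_ : ∀ {n} → EdgeSet n → EdgeSet n → EdgeSet n
(X ∪ₑ Y) u v = X u v ∨ Y u v

_∩ₑ_ : ∀ {n} → EdgeSet n → EdgeSet n → EdgeSet n
(X ∩ₑ Y) u v = X u v ∧ Y u v

record IsRankMatroid {n} (G : Graph n) (r : EdgeSet n → ℕ) : Set where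
  field
    R1 : ∀ X → X ⊆E G → r X ≤ ∣ X ∣ₑ
    R2 : ∀ X Y → X ⊆E G → Y ⊆E G → X ⊆ Y → r X ≤ r Y
    R3 : ∀ X Y → X ⊆E G → Y ⊆E G → r (X ∪ₑ Y) + r (X ∩ₑ Y) ≤ r X + r Y

IsIso : ∀ {n m} → Graph n → Graph m → (Fin n → Fin m) → Set
IsIso G H φ =
  (∀ u v → V G u ≡ true → V G v ≡ true → φ u ≡ φ v → u ≡ v) ×
  (∀ u → V G u ≡ true → V H (φ u) ≡ true) ×
  (∀ w → V H w ≡ true → Σ _ λ u → V G u ≡ true × φ u ≡ w) ×
  (∀ u v → V G u ≡ true → V G v ≡ true → E H (φ u) (φ v) ≡ E G u v)

Image : ∀ {n m} → Graph n → (Fin n → Fin m) → EdgeSet n → EdgeSet m → Set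
Image G φ X Y = ∀ u v → V G u ≡ true → V G v ≡ true → Y (φ u) (φ v) ≡ X u v

_≤G_ : ∀ {n} → Graph n → Graph n → Set
H ≤G G = (∀ u → V H u ≡ true → V G u ≡ true) × (E H ⊆ E G)

record GraphMatroidFamily : Set where
  field
    rk       : ∀ {n} (G : Graph n) → EdgeSet n → ℕ
    matroid  : ∀ {n} (G : Graph n) → IsRankMatroid G (rk G)
    iso-inv  : ∀ {n m} (G : Graph n) (H : Graph m) (φ : Fin n → Fin m) →
               IsIso G H φ → ∀ X Y → X ⊆E G → Y ⊆E H → Image G φ X Y →
               rk H Y ≡ rk G X
    restrict : ∀ {n} (G H : Graph n) → H ≤G G → ∀ X → X ⊆E H →
               rk H X ≡ rk G X
open GraphMatroidFamily public

private
  sym-pair : ∀ {n} (a b u v : Fin n) →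
    ((a == u) ∧ (b == v)) ∨ ((a == v) ∧ (b == u)) ≡
    ((b == u) ∧ (a == v)) ∨ ((b == v) ∧ (a == u))
  sym-pair a b u v =
    trans (∨-comm ((a == u) ∧ (b == v)) ((a == v) ∧ (b == u)))
          (cong₂ _∨_ (∧-comm (a == v) (b == u)) (∧-comm (a == u) (b == v)))

  ∧-true-l : ∀ x y → x ∧ y ≡ true → x ≡ true
  ∧-true-l true  y p = refl
  ∧-true-l false y ()

deleteEdge : ∀ {n} → Graph n → Fin n → Fin n → Graph n
deleteEdge {n} G u v = record
  { V = V G
  ; E = E'
  ; E-sym = λ a b → cong₂ _∧_ (E-sym G a b) (cong not (sym-pair a b u v))
  ; E-irr = λ a → cong (λ z → z ∧ not (((a == u) ∧ (a == v)) ∨ ((a == v) ∧ (a == u)))) (E-irr G a)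
  ; E-V = λ a b p → E-V G a b (∧-true-l _ _ p)
  }
  where
    E' : EdgeSet n
    E' a b = E G a b ∧ not (((a == u) ∧ (b == v)) ∨ ((a == v) ∧ (b == u)))

complete : ∀ {n} → (Fin n → Bool) → Graph n
complete {n} W = record
  { V = W
  ; E = E'
  ; E-sym = λ a b → trans (∧-comm (W a) (W b ∧ not (a == b)))
                     (trans (∧-assoc (W b) (not (a == b)) (W a))
                      (cong (W b ∧_) (trans (∧-comm (not (a == b)) (W a)) (cong (λ z → W a ∧ not z) (==-sym a b)))))
  ; E-irr = λ a → trans (cong (λ z → W a ∧ (W a ∧ not z)) (==-refl a)) (x∧false (W a))
  ; E-V = λ a b p → ∧-true-l _ _ p
  }
  where
    E' : EdgeSet n
    E' a b = W a ∧ (W b ∧ not (a == b))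
    ==-sym : ∀ (a b : Fin n) → (a == b) ≡ (b == a)
    ==-sym a b with a ≟ b | b ≟ a
    ... | Relation.Nullary.yes _ | Relation.Nullary.yes _ = refl
    ... | Relation.Nullary.no _  | Relation.Nullary.no _  = refl
    ... | Relation.Nullary.yes p | Relation.Nullary.no q  = Data.Empty.⊥-elim (q (sym p))
    ... | Relation.Nullary.no p  | Relation.Nullary.yes q = Data.Empty.⊥-elim (p (sym q))
    ==-refl : ∀ (a : Fin n) → (a == a) ≡ true
    ==-refl a with a ≟ a
    ... | Relation.Nullary.yes _ = refl
    ... | Relation.Nullary.no p  = Data.Empty.⊥-elim (p refl)
    x∧false : ∀ x → x ∧ (x ∧ false) ≡ false
    x∧false true  = refl
    x∧false false = refl

_∪G_ : ∀ {n} → Graph n → Graph n → Graph n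
G₁ ∪G G₂ = record
  { V = λ a → V G₁ a ∨ V G₂ a
  ; E = E G₁ ∪ₑ E G₂
  ; E-sym = λ a b → cong₂ _∨_ (E-sym G₁ a b) (E-sym G₂ a b)
  ; E-irr = λ a → cong₂ _∨_ (E-irr G₁ a) (E-irr G₂ a)
  ; E-V = λ a b p → lem a b p
  }
  where
    lem : ∀ a b → E G₁ a b ∨ E G₂ a b ≡ true → V G₁ a ∨ V G₂ a ≡ true
    lem a b p with E G₁ a b in e1
    ... | true  rewrite E-V G₁ a b e1 = refl
    ... | false with V G₁ a
    ...   | true  = refl
    ...   | false = E-V G₂ a b p

commonVertices : ∀ {n} → Graph n → Graph n → ℕ
commonVertices G₁ G₂ = countB (λ a → V G₁ a ∧ V G₂ a)

module _ (M : GraphMatroidFamily) where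

  rank : ∀ {n} → Graph n → ℕ
  rank G = rk M G (E G)

  Independent : ∀ {n} → Graph n → Set
  Independent G = rank G ≡ ∣ E G ∣ₑ

  Circuit : ∀ {n} → Graph n → Set
  Circuit G = ¬ Independent G ×
              (∀ u v → E G u v ≡ true → Independent (deleteEdge G u v))

  Rigid : ∀ {n} → Graph n → Set
  Rigid G = rank G ≡ rank (complete (V G))

  Trivial : Set
  Trivial = ∀ n (G : Graph n) → Independent G

  Nontrivial : Set
  Nontrivial = ¬ Trivial

degree : ∀ {n} → Graph n → Fin n → ℕ
degree G a = countB (E G a)

MinDegree : ∀ {n} → Graph n → ℕ → Set
MinDegree G k = (Σ _ λ a → V G a ≡ true × degree G a ≡ k) ×
                (∀ a → V G a ≡ true → k ≤ degree G a)

module _ (M : GraphMatroidFamily) where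

  CircuitWithMinDeg : ℕ → Set
  CircuitWithMinDeg k = Σ ℕ λ n → Σ (Graph n) λ C → Circuit M C × MinDegree C k

  IsDimensionality : ℕ → Set
  IsDimensionality d = CircuitWithMinDeg (suc d) ×
                       (∀ d' → CircuitWithMinDeg (suc d') → d ≤ d')

  IsThreshold : ℕ → ℕ → Set
  IsThreshold d t =
    (Σ ℕ λ n → Σ (Graph n) λ C → Circuit M C × MinDegree C (suc d) × t ≡ ∣V∣ C ∸ 1) ×
    (∀ n (C : Graph n) → Circuit M C → MinDegree C (suc d) → t ≤ ∣V∣ C ∸ 1)

-- Work in the matroid of the complete graph B on V(G₁) ∪ V(G₂), where A spans C if r(A ∪ C) = r(A).
-- Rigidity says that E(Gᵢ) spans the complete graph Kᵢ on V(Gᵢ), so it suffices that K₁ ∪ K₂ spans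
-- every edge uv of B; the only edges not already in K₁ ∪ K₂ join some u ∈ V₁ ∖ V₂ to some v ∈ V₂ ∖ V₁.
-- For these, take an M-circuit C on t + 1 vertices (given by the threshold) with an edge xy, and copy C
-- injectively into B by x ↦ u, y ↦ v and the other t − 1 vertices into the common vertices. The copy H
-- inherits r(H − uv) = r(H) from C, so H − uv spans uv, while every edge of H − uv lies inside V₁ or
-- inside V₂.

module Submission where

open import Defs
open import Data.Nat using (ℕ; zero; suc; _+_; _∸_; _≤_; _<_; z≤n; s≤s; _<ᵇ_)
open import Data.Nat.Properties
  using ( ≤-refl; ≤-trans; ≤-antisym; ≤-reflexive; ≤-pred; ≤∧≢⇒<; m≤n+m; m≤n+m∸n; n≤1+n
        ; +-comm; +-suc; +-mono-≤; +-monoʳ-≤; +-cancelʳ-≤; <ᵇ⇒<; <-asym; <-irrefl; <-cmp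
        ; module ≤-Reasoning )
open import Data.Fin using (Fin; toℕ; _≟_)
import Data.Fin as F
open import Data.Fin.Properties using (toℕ-injective; suc-injective)
open import Data.Bool using (Bool; true; false; _∧_; _∨_; not; if_then_else_; T)
open import Data.Bool.Properties using (∧-conicalˡ; ∧-conicalʳ; ∧-identityʳ; not-injective; not-¬; ¬-not; ⇔→≡)
open import Data.Product using (Σ; ∃-syntax; _×_; _,_; proj₁; proj₂)
open import Data.Sum using (_⊎_; inj₁; inj₂; [_,_]′)
open import Data.Empty using (⊥-elim)
open import Function using (_∘_; mk⇔)
open import Data.Vec.Functional using (_∷_)
open import Relation.Nullary using (Dec; yes; no)
open import Relation.Binary using (tri<; tri≈; tri>)
open import Relation.Binary.PropositionalEquality
  using (_≡_; _≢_; refl; sym; trans; cong; cong₂; subst; subst₂; module ≡-Reasoning)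

∧-intro : ∀ {a b} → a ≡ true → b ≡ true → a ∧ b ≡ true
∧-intro refl refl = refl

∨-introˡ : ∀ {a b} → a ≡ true → a ∨ b ≡ true
∨-introˡ refl = refl

∨-introʳ : ∀ {a b} → b ≡ true → a ∨ b ≡ true
∨-introʳ {true}  _ = refl
∨-introʳ {false} p = p

∨-elim : ∀ {a b} → a ∨ b ≡ true → a ≡ true ⊎ b ≡ true
∨-elim {true}  _ = inj₁ refl
∨-elim {false} p = inj₂ p

==⇒≡ : ∀ {n} {a b : Fin n} → (a == b) ≡ true → a ≡ b
==⇒≡ {a = a} {b} p with a ≟ b
... | yes a≡b = a≡b

≡⇒== : ∀ {n} {a b : Fin n} → a ≡ b → (a == b) ≡ true
≡⇒== {a = a} {b} a≡b with a ≟ b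
... | yes _   = refl
... | no a≢b = ⊥-elim (a≢b a≡b)

≢⇒== : ∀ {n} {a b : Fin n} → a ≢ b → (a == b) ≡ false
≢⇒== {a = a} {b} a≢b with a ≟ b
... | yes a≡b = ⊥-elim (a≢b a≡b)
... | no _    = refl

==-refl : ∀ {n} (a : Fin n) → (a == a) ≡ true
==-refl a = ≡⇒== {a = a} refl

==-suc : ∀ {n} (a b : Fin n) → (F.suc a == F.suc b) ≡ (a == b)
==-suc a b with a ≟ b
... | yes _ = refl
... | no _  = refl

countB-cong : ∀ {n} {f g : Fin n → Bool} → (∀ i → f i ≡ g i) → countB f ≡ countB g
countB-cong {zero}  f≗g = refl
countB-cong {suc n} f≗g =
  cong₂ _+_ (cong (λ b → if b then 1 else 0) (f≗g F.zero)) (countB-cong (λ i → f≗g (F.suc i)))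

indicator-mono : ∀ {a b} → (a ≡ true → b ≡ true) → (if a then 1 else 0) ≤ (if b then 1 else 0)
indicator-mono {false}         _   = z≤n
indicator-mono {true}  {true}  _   = ≤-refl
indicator-mono {true}  {false} a⇒b with () ← a⇒b refl

indicator≤1 : ∀ a → (if a then 1 else 0) ≤ 1
indicator≤1 true  = ≤-refl
indicator≤1 false = z≤n

countB-mono : ∀ {n} {f g : Fin n → Bool} → (∀ i → f i ≡ true → g i ≡ true) → countB f ≤ countB g
countB-mono {zero}  f⊆g = z≤n
countB-mono {suc n} f⊆g = +-mono-≤ (indicator-mono (f⊆g F.zero)) (countB-mono (λ i → f⊆g (F.suc i)))

countB-≤-suc : ∀ {n} {f g : Fin n → Bool} (j : Fin n) →
               (∀ i → f i ≡ true → g i ≡ true ⊎ i ≡ j) → countB f ≤ suc (countB g)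
countB-≤-suc {suc n} {f} {g} F.zero f⊆g∪j =
  +-mono-≤ (indicator≤1 (f F.zero)) (≤-trans (countB-mono tail) (m≤n+m _ _))
  where
    tail : ∀ i → f (F.suc i) ≡ true → g (F.suc i) ≡ true
    tail i p with f⊆g∪j (F.suc i) p
    ... | inj₁ q = q
countB-≤-suc {suc n} {f} {g} (F.suc j) f⊆g∪j =
  ≤-trans (+-mono-≤ (indicator-mono head) (countB-≤-suc j tail)) (≤-reflexive (+-suc _ _))
  where
    head : f F.zero ≡ true → g F.zero ≡ true
    head p with f⊆g∪j F.zero p
    ... | inj₁ q = q
    tail : ∀ i → f (F.suc i) ≡ true → g (F.suc i) ≡ true ⊎ i ≡ j
    tail i p with f⊆g∪j (F.suc i) p
    ... | inj₁ q    = inj₁ q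
    ... | inj₂ refl = inj₂ refl

countB-witness : ∀ {n} (f : Fin n → Bool) → 0 < countB f → ∃[ i ] f i ≡ true
countB-witness {suc n} f pos with f F.zero in e
... | true  = F.zero , e
... | false with i , p ← countB-witness (λ i → f (F.suc i)) pos = F.suc i , p

_∖_ : ∀ {n} → (Fin n → Bool) → Fin n → Fin n → Bool
(f ∖ j) i = f i ∧ not (i == j)

countB-remove : ∀ {n} (f : Fin n → Bool) {j} → f j ≡ true → countB f ≡ suc (countB (f ∖ j))
countB-remove {suc n} f {F.zero} fj rewrite fj =
  cong suc (countB-cong (λ i → sym (∧-identityʳ (f (F.suc i)))))
countB-remove {suc n} f {F.suc j} fj = begin
  head + countB (f ∘ F.suc)              ≡⟨ cong (head +_) (countB-remove (f ∘ F.suc) fj) ⟩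
  head + suc (countB ((f ∘ F.suc) ∖ j))  ≡⟨ +-suc head _ ⟩
  suc (head + countB ((f ∘ F.suc) ∖ j))  ≡⟨ cong suc (cong₂ _+_ head≡ (countB-cong tail≡)) ⟩
  suc (countB (f ∖ F.suc j))             ∎
  where
    open ≡-Reasoning
    head = if f F.zero then 1 else 0
    head≡ : head ≡ (if f F.zero ∧ true then 1 else 0)
    head≡ = cong (λ b → if b then 1 else 0) (sym (∧-identityʳ (f F.zero)))
    tail≡ : ∀ i → ((f ∘ F.suc) ∖ j) i ≡ (f ∖ F.suc j) (F.suc i)
    tail≡ i = cong (λ b → f (F.suc i) ∧ not b) (sym (==-suc i j))

sumF-mono : ∀ {n} {f g : Fin n → ℕ} → (∀ i → f i ≤ g i) → sumF f ≤ sumF g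
sumF-mono {zero}  f≤g = z≤n
sumF-mono {suc n} f≤g = +-mono-≤ (f≤g F.zero) (sumF-mono (λ i → f≤g (F.suc i)))

sumF-≤-suc : ∀ {n} {f g : Fin n → ℕ} (j : Fin n) →
             (∀ i → i ≢ j → f i ≤ g i) → f j ≤ suc (g j) → sumF f ≤ suc (sumF g)
sumF-≤-suc {suc n} F.zero    f≤g fj≤ = +-mono-≤ fj≤ (sumF-mono (λ i → f≤g (F.suc i) λ ()))
sumF-≤-suc {suc n} (F.suc j) f≤g fj≤ =
  ≤-trans (+-mono-≤ (f≤g F.zero λ ()) (sumF-≤-suc j (λ i i≢j → f≤g (F.suc i) (i≢j ∘ suc-injective)) fj≤))
          (≤-reflexive (+-suc _ _))

sumF-witness : ∀ {n} (f : Fin n → ℕ) → 0 < sumF f → ∃[ i ] 0 < f i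
sumF-witness {suc n} f pos with f F.zero in e
... | suc _ = F.zero , subst (0 <_) (sym e) (s≤s z≤n)
... | zero  with i , p ← sumF-witness (λ i → f (F.suc i)) pos = F.suc i , p

InjectiveOn : ∀ {m n} → (Fin m → Bool) → (Fin m → Fin n) → Set
InjectiveOn P ι = ∀ i j → P i ≡ true → P j ≡ true → ι i ≡ ι j → i ≡ j

countB-≤⇒injection : ∀ {m n} (f : Fin m → Bool) (g : Fin n → Bool) → Fin n → countB f ≤ countB g →
                     Σ (Fin m → Fin n) λ ι → (∀ i → f i ≡ true → g (ι i) ≡ true) × InjectiveOn f ι
countB-≤⇒injection {zero} f g _ _ = (λ ()) , (λ ()) , (λ ())
countB-≤⇒injection {suc m} f g default f≤g with f F.zero in f₀
... | false =
  let ι , ι-g , ι-inj = countB-≤⇒injection (λ i → f (F.suc i)) g default f≤g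
      ι-g′ : ∀ i → f i ≡ true → g ((default ∷ ι) i) ≡ true
      ι-g′ = λ { F.zero p → ⊥-elim (not-¬ p f₀) ; (F.suc i) p → ι-g i p }
      ι-inj′ : InjectiveOn f (default ∷ ι)
      ι-inj′ = λ { F.zero _ p _ _ → ⊥-elim (not-¬ p f₀) ; _ F.zero _ p _ → ⊥-elim (not-¬ p f₀)
                 ; (F.suc i) (F.suc j) p q e → cong F.suc (ι-inj i j p q e) }
  in default ∷ ι , ι-g′ , ι-inj′
... | true =
  let j₀ , gj₀ = countB-witness g (≤-trans (s≤s z≤n) f≤g)
      bound = ≤-pred (≤-trans f≤g (≤-reflexive (countB-remove g gj₀)))
      ι , ι-g , ι-inj = countB-≤⇒injection (λ i → f (F.suc i)) (g ∖ j₀) default bound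
      ι-g′ : ∀ i → f i ≡ true → g ((j₀ ∷ ι) i) ≡ true
      ι-g′ = λ { F.zero _ → gj₀ ; (F.suc i) p → ∧-conicalˡ _ _ (ι-g i p) }
      ι≢j₀ : ∀ i → f (F.suc i) ≡ true → ι i ≢ j₀
      ι≢j₀ i p e = not-¬ (≡⇒== e) (not-injective (∧-conicalʳ _ _ (ι-g i p)))
      ι-inj′ : InjectiveOn f (j₀ ∷ ι)
      ι-inj′ = λ { F.zero F.zero _ _ _ → refl
                 ; F.zero (F.suc j) _ q e → ⊥-elim (ι≢j₀ j q (sym e))
                 ; (F.suc i) F.zero p _ e → ⊥-elim (ι≢j₀ i p e)
                 ; (F.suc i) (F.suc j) p q e → cong F.suc (ι-inj i j p q e) }
  in j₀ ∷ ι , ι-g′ , ι-inj′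

-- The unordered pair {x, y}; deleteEdge G x y removes exactly this set from E G.
edge : ∀ {n} → Fin n → Fin n → EdgeSet n
edge x y a b = ((a == x) ∧ (b == y)) ∨ ((a == y) ∧ (b == x))

edge-elim : ∀ {n} {x y a b : Fin n} → edge x y a b ≡ true → (a ≡ x × b ≡ y) ⊎ (a ≡ y × b ≡ x)
edge-elim {x = x} {y} {a} {b} p with ∨-elim {(a == x) ∧ (b == y)} p
... | inj₁ q = inj₁ (==⇒≡ (∧-conicalˡ _ _ q) , ==⇒≡ (∧-conicalʳ _ _ q))
... | inj₂ q = inj₂ (==⇒≡ (∧-conicalˡ _ _ q) , ==⇒≡ (∧-conicalʳ _ _ q))

edge-intro : ∀ {n} {x y a b : Fin n} → (a ≡ x × b ≡ y) ⊎ (a ≡ y × b ≡ x) → edge x y a b ≡ true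
edge-intro {x = x} {y} (inj₁ (refl , refl)) = ∨-introˡ (∧-intro (==-refl x) (==-refl y))
edge-intro {x = x} {y} (inj₂ (refl , refl)) =
  ∨-introʳ {(y == x) ∧ (x == y)} (∧-intro (==-refl y) (==-refl x))

edge-swap : ∀ {n} {x y a b : Fin n} → edge x y a b ≡ true → edge y x a b ≡ true
edge-swap {x = x} {y} {a} {b} p = edge-intro {x = y} {x} {a} {b} ([ inj₂ , inj₁ ]′ (edge-elim {x = x} {y} p))

edge-flip : ∀ {n} {x y a b : Fin n} → edge x y a b ≡ true → edge x y b a ≡ true
edge-flip {x = x} {y} {a} {b} p = edge-intro {x = x} {y} {b} {a}
  ([ (λ (a≡x , b≡y) → inj₂ (b≡y , a≡x)) , (λ (a≡y , b≡x) → inj₁ (b≡x , a≡y)) ]′ (edge-elim {x = x} {y} p))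

<ᵇ-true⇒< : ∀ {m n} → (m <ᵇ n) ≡ true → m < n
<ᵇ-true⇒< p = <ᵇ⇒< _ _ (subst T (sym p) _)

private
  ∣∣ₑ-≤-suc-ordered : ∀ {n} {X Y : EdgeSet n} {x y : Fin n} → toℕ x < toℕ y →
                      X ⊆ (Y ∪ₑ edge x y) → ∣ X ∣ₑ ≤ suc ∣ Y ∣ₑ
  ∣∣ₑ-≤-suc-ordered {X = X} {Y} {x} {y} x<y X⊆Y+xy = sumF-≤-suc x other-row row-x
    where
      other-row : ∀ u → u ≢ x →
                  countB (λ v → (toℕ u <ᵇ toℕ v) ∧ X u v) ≤ countB (λ v → (toℕ u <ᵇ toℕ v) ∧ Y u v)
      other-row u u≢x = countB-mono λ v p →
        ∧-intro (∧-conicalˡ _ _ p) (in-Y v (∧-conicalˡ _ _ p) (∨-elim (X⊆Y+xy u v (∧-conicalʳ _ _ p))))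
        where
          in-Y : ∀ v → (toℕ u <ᵇ toℕ v) ≡ true → Y u v ≡ true ⊎ edge x y u v ≡ true → Y u v ≡ true
          in-Y v _   (inj₁ q) = q
          in-Y v u<v (inj₂ q) with edge-elim {x = x} {y} q
          ... | inj₁ (u≡x , _)   = ⊥-elim (u≢x u≡x)
          ... | inj₂ (u≡y , v≡x) =
            ⊥-elim (<-asym x<y (subst₂ (λ a b → toℕ a < toℕ b) u≡y v≡x (<ᵇ-true⇒< u<v)))
      row-x : countB (λ v → (toℕ x <ᵇ toℕ v) ∧ X x v) ≤ suc (countB (λ v → (toℕ x <ᵇ toℕ v) ∧ Y x v))
      row-x = countB-≤-suc y λ v p → in-Y-or-y v (∧-conicalˡ _ _ p) (∨-elim (X⊆Y+xy x v (∧-conicalʳ _ _ p)))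
        where
          in-Y-or-y : ∀ v → (toℕ x <ᵇ toℕ v) ≡ true → Y x v ≡ true ⊎ edge x y x v ≡ true →
                      ((toℕ x <ᵇ toℕ v) ∧ Y x v) ≡ true ⊎ v ≡ y
          in-Y-or-y v x<v (inj₁ q) = inj₁ (∧-intro x<v q)
          in-Y-or-y v x<v (inj₂ q) with edge-elim {x = x} {y} q
          ... | inj₁ (_ , v≡y) = inj₂ v≡y
          ... | inj₂ (x≡y , _) = ⊥-elim (<-irrefl (cong toℕ x≡y) x<y)

∣∣ₑ-≤-suc : ∀ {n} {X Y : EdgeSet n} {x y : Fin n} → x ≢ y →
            X ⊆ (Y ∪ₑ edge x y) → ∣ X ∣ₑ ≤ suc ∣ Y ∣ₑ
∣∣ₑ-≤-suc {Y = Y} {x} {y} x≢y X⊆Y+xy with <-cmp (toℕ x) (toℕ y)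
... | tri< x<y _ _ = ∣∣ₑ-≤-suc-ordered x<y X⊆Y+xy
... | tri≈ _ x≡y _ = ⊥-elim (x≢y (toℕ-injective x≡y))
... | tri> _ _ y<x = ∣∣ₑ-≤-suc-ordered y<x λ a b p →
  [ ∨-introˡ , (λ q → ∨-introʳ {Y a b} (edge-swap {x = x} {y} {a} {b} q)) ]′ (∨-elim {Y a b} (X⊆Y+xy a b p))

E-Vʳ : ∀ {n} (G : Graph n) {a b} → E G a b ≡ true → V G b ≡ true
E-Vʳ G {a} {b} p = E-V G b a (trans (E-sym G b a) p)

E-≢ : ∀ {n} (G : Graph n) {a b} → E G a b ≡ true → a ≢ b
E-≢ G {a} p refl = not-¬ p (E-irr G a)

E-⊆E : ∀ {n} (G : Graph n) → E G ⊆E G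
E-⊆E G = (λ _ _ p → p) , E-sym G

≤G-refl : ∀ {n} {G : Graph n} → G ≤G G
≤G-refl = (λ _ p → p) , (λ _ _ p → p)

deleteEdge-≤G : ∀ {n} (G : Graph n) (x y : Fin n) → deleteEdge G x y ≤G G
deleteEdge-≤G G x y = (λ _ p → p) , (λ _ _ p → ∧-conicalˡ _ _ p)

deleteEdge-⊆E : ∀ {n} (G : Graph n) (x y : Fin n) → E (deleteEdge G x y) ⊆E G
deleteEdge-⊆E G x y = proj₂ (deleteEdge-≤G G x y) , E-sym (deleteEdge G x y)

E⊆deleteEdge∪edge : ∀ {n} (G : Graph n) (x y : Fin n) → E G ⊆ (E (deleteEdge G x y) ∪ₑ edge x y)
E⊆deleteEdge∪edge G x y a b p with edge x y a b
... | true  = ∨-introʳ {E G a b ∧ false} refl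
... | false = ∨-introˡ (∧-intro p refl)

complete-edge : ∀ {n} (U : Fin n → Bool) {a b} → U a ≡ true → U b ≡ true → a ≢ b → E (complete U) a b ≡ true
complete-edge U Ua Ub a≢b = ∧-intro Ua (∧-intro Ub (cong not (≢⇒== a≢b)))

≤G-complete : ∀ {n} {U : Fin n → Bool} (H : Graph n) → (∀ a → V H a ≡ true → U a ≡ true) → H ≤G complete U
≤G-complete {U = U} H VH⊆U =
  VH⊆U , λ a b p → complete-edge U (VH⊆U a (E-V H a b p)) (VH⊆U b (E-Vʳ H p)) (E-≢ H p)

module _ (M : GraphMatroidFamily) {m} {C : Graph m} (circuit : Circuit M C) where

  private
    rank≤∣E∣ : rank M C ≤ ∣ E C ∣ₑ
    rank≤∣E∣ = IsRankMatroid.R1 (matroid M C) (E C) (E-⊆E C)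

    rank<∣E∣ : rank M C < ∣ E C ∣ₑ
    rank<∣E∣ = ≤∧≢⇒< rank≤∣E∣ (proj₁ circuit)

  circuit-edge : ∃[ x ] ∃[ y ] E C x y ≡ true
  circuit-edge =
    let x , row-x = sumF-witness _ (≤-trans (s≤s z≤n) rank<∣E∣)
        y , xy    = countB-witness _ row-x
    in x , y , ∧-conicalʳ _ _ xy

  circuit-rank-deleteEdge : ∀ {x y} → E C x y ≡ true → rk M C (E (deleteEdge C x y)) ≡ rank M C
  circuit-rank-deleteEdge {x} {y} xy = ≤-antisym
    (IsRankMatroid.R2 (matroid M C) _ _ (deleteEdge-⊆E C x y) (E-⊆E C) (proj₂ (deleteEdge-≤G C x y)))
    (≤-pred (begin-strict
      rank M C               <⟨ rank<∣E∣ ⟩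
      ∣ E C ∣ₑ               ≤⟨ ∣∣ₑ-≤-suc (E-≢ C xy) (E⊆deleteEdge∪edge C x y) ⟩
      suc ∣ E C′ ∣ₑ          ≡⟨ cong suc (sym (proj₂ circuit x y xy)) ⟩
      suc (rank M C′)        ≡⟨ cong suc (restrict M C C′ (deleteEdge-≤G C x y) (E C′) (E-⊆E C′)) ⟩
      suc (rk M C (E C′))    ∎))
    where
      C′ = deleteEdge C x y
      open ≤-Reasoning

injectiveOn-== : ∀ {m n} {P : Fin m → Bool} {φ : Fin m → Fin n} → InjectiveOn P φ →
                 ∀ {a b} → P a ≡ true → P b ≡ true → (φ a == φ b) ≡ (a == b)
injectiveOn-== {φ = φ} φ-inj Pa Pb =
  ⇔→≡ (mk⇔ (λ p → ≡⇒== (φ-inj _ _ Pa Pb (==⇒≡ p))) (λ p → ≡⇒== (cong φ (==⇒≡ p))))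

module _ (M : GraphMatroidFamily) {m n} {C : Graph m} {H : Graph n} {φ : Fin m → Fin n}
         (iso : IsIso C H φ) where

  private
    φ-inj = proj₁ iso
    φ-E   = proj₂ (proj₂ (proj₂ iso))

  rank-≅ : rank M H ≡ rank M C
  rank-≅ = iso-inv M C H φ iso (E C) (E H) (E-⊆E C) (E-⊆E H) φ-E

  rank-deleteEdge-≅ : ∀ {x y} → V C x ≡ true → V C y ≡ true →
                      rk M H (E (deleteEdge H (φ x) (φ y))) ≡ rk M C (E (deleteEdge C x y))
  rank-deleteEdge-≅ {x} {y} Vx Vy =
    iso-inv M C H φ iso _ _ (deleteEdge-⊆E C x y) (deleteEdge-⊆E H (φ x) (φ y)) image
    where
      ==-φ : ∀ {a b} → V C a ≡ true → V C b ≡ true → (φ a == φ b) ≡ (a == b)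
      ==-φ = injectiveOn-== φ-inj
      image : Image C φ (E (deleteEdge C x y)) (E (deleteEdge H (φ x) (φ y)))
      image a b Va Vb = cong₂ _∧_ (φ-E a b Va Vb) (cong not (cong₂ _∨_
        (cong₂ _∧_ (==-φ Va Vx) (==-φ Vb Vy)) (cong₂ _∧_ (==-φ Va Vy) (==-φ Vb Vx))))

anyF : ∀ {m} → (Fin m → Bool) → Bool
anyF {zero}  f = false
anyF {suc m} f = f F.zero ∨ anyF (λ i → f (F.suc i))

anyF-intro : ∀ {m} (f : Fin m → Bool) i → f i ≡ true → anyF f ≡ true
anyF-intro f F.zero    p = ∨-introˡ p
anyF-intro f (F.suc i) p = ∨-introʳ {f F.zero} (anyF-intro (λ i → f (F.suc i)) i p)

anyF-elim : ∀ {m} (f : Fin m → Bool) → anyF f ≡ true → ∃[ i ] f i ≡ true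
anyF-elim {suc m} f p with ∨-elim {f F.zero} p
... | inj₁ q = F.zero , q
... | inj₂ q with i , r ← anyF-elim (λ i → f (F.suc i)) q = F.suc i , r

module _ {m n} (C : Graph m) (φ : Fin m → Fin n) (φ-inj : InjectiveOn (V C) φ) where

  private
    V′ : Fin n → Bool
    V′ a = anyF λ c → V C c ∧ (φ c == a)

    E′ : EdgeSet n
    E′ a b = anyF λ c → anyF λ d → E C c d ∧ ((φ c == a) ∧ (φ d == b))

  image-vertex-elim : ∀ {a} → V′ a ≡ true → ∃[ c ] V C c ≡ true × φ c ≡ a
  image-vertex-elim p =
    let c , q = anyF-elim _ p in c , ∧-conicalˡ _ _ q , ==⇒≡ (∧-conicalʳ _ _ q)

  image-edge-elim : ∀ {a b} → E′ a b ≡ true → ∃[ c ] ∃[ d ] E C c d ≡ true × φ c ≡ a × φ d ≡ b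
  image-edge-elim p =
    let c , q = anyF-elim _ p
        d , r = anyF-elim _ q
        s     = ∧-conicalʳ (E C c d) _ r
    in c , d , ∧-conicalˡ _ _ r , ==⇒≡ (∧-conicalˡ _ _ s) , ==⇒≡ (∧-conicalʳ _ _ s)

  image-edge-intro : ∀ {c d} → E C c d ≡ true → E′ (φ c) (φ d) ≡ true
  image-edge-intro {c} {d} p =
    anyF-intro _ c (anyF-intro _ d (∧-intro {E C c d} p (∧-intro (==-refl (φ c)) (==-refl (φ d)))))

  private
    E′-flip : ∀ {a b} → E′ a b ≡ true → E′ b a ≡ true
    E′-flip p with c , d , cd , refl , refl ← image-edge-elim p =
      image-edge-intro (trans (E-sym C d c) cd)

  imageGraph : Graph n
  imageGraph = record
    { V     = V′
    ; E     = E′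
    ; E-sym = λ a b → ⇔→≡ (mk⇔ E′-flip E′-flip)
    ; E-irr = λ a → ¬-not λ p →
        let c , d , cd , φc≡a , φd≡a = image-edge-elim p
        in E-≢ C cd (φ-inj c d (E-V C c d cd) (E-Vʳ C cd) (trans φc≡a (sym φd≡a)))
    ; E-V   = λ a b p →
        let c , d , cd , φc≡a , _ = image-edge-elim p
        in anyF-intro _ c (∧-intro (E-V C c d cd) (≡⇒== φc≡a))
    }

  image-edge-≡ : ∀ {a b} → V C a ≡ true → V C b ≡ true → E′ (φ a) (φ b) ≡ E C a b
  image-edge-≡ {a} {b} Va Vb = ⇔→≡ (mk⇔ preimage image-edge-intro)
    where
      preimage : E′ (φ a) (φ b) ≡ true → E C a b ≡ true
      preimage p =
        let c , d , cd , φc≡φa , φd≡φb = image-edge-elim p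
        in subst₂ (λ c d → E C c d ≡ true)
                  (φ-inj c a (E-V C c d cd) Va φc≡φa) (φ-inj d b (E-Vʳ C cd) Vb φd≡φb) cd

  imageGraph-≅ : IsIso C imageGraph φ
  imageGraph-≅ =
    φ-inj ,
    (λ c Vc → anyF-intro _ c (∧-intro Vc (==-refl (φ c)))) ,
    (λ _ → image-vertex-elim) ,
    (λ _ _ → image-edge-≡)

record Embedding {m n} (C : Graph m) (x y : Fin m) (u v : Fin n) (T : Fin n → Bool) : Set where
  field
    φ     : Fin m → Fin n
    φ-x   : φ x ≡ u
    φ-y   : φ y ≡ v
    φ-T   : ∀ c → V C c ≡ true → c ≢ x → c ≢ y → T (φ c) ≡ true
    φ-inj : InjectiveOn (V C) φ

module _ {m n} (C : Graph m) {x y : Fin m} {u v : Fin n} {T : Fin n → Bool}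
         (Vx : V C x ≡ true) (Vy : V C y ≡ true) (x≢y : x ≢ y)
         (u≢v : u ≢ v) (u∉T : T u ≡ false) (v∉T : T v ≡ false)
         (enough : ∣V∣ C ≤ 2 + countB T) where

  private
    rest : Fin m → Bool
    rest = (V C ∖ x) ∖ y

    in-rest : ∀ {c} → V C c ≡ true → c ≢ x → c ≢ y → rest c ≡ true
    in-rest Vc c≢x c≢y = ∧-intro (∧-intro Vc (cong not (≢⇒== c≢x))) (cong not (≢⇒== c≢y))

    ∣V∣≡2+rest : ∣V∣ C ≡ 2 + countB rest
    ∣V∣≡2+rest = trans (countB-remove (V C) Vx)
                       (cong suc (countB-remove (V C ∖ x) (∧-intro Vy (cong not (≢⇒== (x≢y ∘ sym))))))

    injection : Σ (Fin m → Fin n) λ ι → (∀ c → rest c ≡ true → T (ι c) ≡ true) × InjectiveOn rest ι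
    injection = countB-≤⇒injection rest T u (≤-pred (≤-pred (subst (_≤ 2 + countB T) ∣V∣≡2+rest enough)))

    ι     = proj₁ injection
    ι-T   = proj₁ (proj₂ injection)
    ι-inj = proj₂ (proj₂ injection)

    φ : Fin m → Fin n
    φ c with c ≟ x | c ≟ y
    ... | yes _ | _     = u
    ... | no _  | yes _ = v
    ... | no _  | no _  = ι c

    φ-cases : ∀ c → (c ≡ x × φ c ≡ u) ⊎ (c ≡ y × φ c ≡ v) ⊎ (c ≢ x × c ≢ y × φ c ≡ ι c)
    φ-cases c with c ≟ x | c ≟ y
    ... | yes c≡x | _       = inj₁ (c≡x , refl)
    ... | no _    | yes c≡y = inj₂ (inj₁ (c≡y , refl))
    ... | no c≢x  | no c≢y  = inj₂ (inj₂ (c≢x , c≢y , refl))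

    φ-T : ∀ c → V C c ≡ true → c ≢ x → c ≢ y → T (φ c) ≡ true
    φ-T c Vc c≢x c≢y with φ-cases c
    ... | inj₁ (c≡x , _)         = ⊥-elim (c≢x c≡x)
    ... | inj₂ (inj₁ (c≡y , _))  = ⊥-elim (c≢y c≡y)
    ... | inj₂ (inj₂ (_ , _ , φc≡ιc)) = subst (λ a → T a ≡ true) (sym φc≡ιc) (ι-T c (in-rest Vc c≢x c≢y))

    φ-x : φ x ≡ u
    φ-x with φ-cases x
    ... | inj₁ (_ , φx≡u)           = φx≡u
    ... | inj₂ (inj₁ (x≡y , _))     = ⊥-elim (x≢y x≡y)
    ... | inj₂ (inj₂ (x≢x , _ , _)) = ⊥-elim (x≢x refl)

    φ-y : φ y ≡ v
    φ-y with φ-cases y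
    ... | inj₁ (y≡x , _)            = ⊥-elim (x≢y (sym y≡x))
    ... | inj₂ (inj₁ (_ , φy≡v))    = φy≡v
    ... | inj₂ (inj₂ (_ , y≢y , _)) = ⊥-elim (y≢y refl)

    outside-T : ∀ {c a} → V C c ≡ true → φ c ≡ a → T a ≡ false → c ≡ x ⊎ c ≡ y
    outside-T {c} Vc φc≡a a∉T with φ-cases c
    ... | inj₁ (c≡x , _)              = inj₁ c≡x
    ... | inj₂ (inj₁ (c≡y , _))       = inj₂ c≡y
    ... | inj₂ (inj₂ (c≢x , c≢y , _)) = ⊥-elim (not-¬ (subst (λ a → T a ≡ true) φc≡a (φ-T c Vc c≢x c≢y)) a∉T)

    φ⁻¹-u : ∀ {c} → V C c ≡ true → φ c ≡ u → c ≡ x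
    φ⁻¹-u Vc φc≡u with outside-T Vc φc≡u u∉T
    ... | inj₁ c≡x    = c≡x
    ... | inj₂ refl   = ⊥-elim (u≢v (trans (sym φc≡u) φ-y))

    φ⁻¹-v : ∀ {c} → V C c ≡ true → φ c ≡ v → c ≡ y
    φ⁻¹-v Vc φc≡v with outside-T Vc φc≡v v∉T
    ... | inj₁ refl   = ⊥-elim (u≢v (trans (sym φ-x) φc≡v))
    ... | inj₂ c≡y    = c≡y

    φ-inj : InjectiveOn (V C) φ
    φ-inj c d Vc Vd φc≡φd with φ-cases d
    ... | inj₁ (d≡x , φd≡u)        = trans (φ⁻¹-u Vc (trans φc≡φd φd≡u)) (sym d≡x)
    ... | inj₂ (inj₁ (d≡y , φd≡v)) = trans (φ⁻¹-v Vc (trans φc≡φd φd≡v)) (sym d≡y)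
    ... | inj₂ (inj₂ (d≢x , d≢y , φd≡ιd)) with φ-cases c
    ...   | inj₁ (_ , φc≡u)        = ⊥-elim (d≢x (φ⁻¹-u Vd (trans (sym φc≡φd) φc≡u)))
    ...   | inj₂ (inj₁ (_ , φc≡v)) = ⊥-elim (d≢y (φ⁻¹-v Vd (trans (sym φc≡φd) φc≡v)))
    ...   | inj₂ (inj₂ (c≢x , c≢y , φc≡ιc)) =
      ι-inj c d (in-rest Vc c≢x c≢y) (in-rest Vd d≢x d≢y) (trans (sym φc≡ιc) (trans φc≡φd φd≡ιd))

  -- Opaque, so that clients see φ only through the fields: its `with`-definition
  -- would otherwise surface in their goals.
  opaque
    embedding : Embedding C x y u v T
    embedding = record { φ = φ ; φ-x = φ-x ; φ-y = φ-y ; φ-T = φ-T ; φ-inj = φ-inj }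

module Spanning {n} {B : Graph n} {r : EdgeSet n → ℕ} (isMatroid : IsRankMatroid B r) where

  open IsRankMatroid isMatroid

  record EdgeSubset : Set where
    constructor subset
    field
      edges   : EdgeSet n
      edges⊆E : edges ⊆E B
  open EdgeSubset public

  record _⊆ˢ_ (A A′ : EdgeSubset) : Set where
    constructor ⊆⇒⊆ˢ
    field
      ⊆ˢ⇒⊆ : edges A ⊆ edges A′
  open _⊆ˢ_ public

  ρ : EdgeSubset → ℕ
  ρ A = r (edges A)

  ∅ : EdgeSubset
  ∅ = subset (λ _ _ → false) ((λ _ _ ()) , λ _ _ → refl)

  -- ∪ and ∩ are opaque so that they stay folded in types, which lets Agda infer
  -- the implicit arguments of the lattice lemmas below.
  opaque
    _∪_ : EdgeSubset → EdgeSubset → EdgeSubset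
    subset X (X⊆B , X-sym) ∪ subset Y (Y⊆B , Y-sym) = subset (X ∪ₑ Y)
      ( (λ a b p → [ X⊆B a b , Y⊆B a b ]′ (∨-elim {X a b} p)) , λ a b → cong₂ _∨_ (X-sym a b) (Y-sym a b))

    _∩_ : EdgeSubset → EdgeSubset → EdgeSubset
    subset X (X⊆B , X-sym) ∩ subset Y (Y⊆B , Y-sym) = subset (X ∩ₑ Y)
      ( (λ a b p → X⊆B a b (∧-conicalˡ _ _ p)) , λ a b → cong₂ _∧_ (X-sym a b) (Y-sym a b))

  opaque
    unfolding _∪_ _∩_

    ∪-upperˡ : ∀ {A C} → A ⊆ˢ (A ∪ C)
    ∪-upperˡ = ⊆⇒⊆ˢ λ _ _ → ∨-introˡ

    ∪-upperʳ : ∀ {A C} → C ⊆ˢ (A ∪ C)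
    ∪-upperʳ {A} = ⊆⇒⊆ˢ λ a b → ∨-introʳ {edges A a b}

    ∪-least : ∀ {A C D} → A ⊆ˢ D → C ⊆ˢ D → (A ∪ C) ⊆ˢ D
    ∪-least {A} (⊆⇒⊆ˢ A⊆D) (⊆⇒⊆ˢ C⊆D) = ⊆⇒⊆ˢ λ a b p → [ A⊆D a b , C⊆D a b ]′ (∨-elim {edges A a b} p)

    ⊆ˢ-∪ : ∀ {A C D} → edges A ⊆ (edges C ∪ₑ edges D) → A ⊆ˢ (C ∪ D)
    ⊆ˢ-∪ = ⊆⇒⊆ˢ

    ∩-greatest : ∀ {A C D} → D ⊆ˢ A → D ⊆ˢ C → D ⊆ˢ (A ∩ C)
    ∩-greatest (⊆⇒⊆ˢ D⊆A) (⊆⇒⊆ˢ D⊆C) = ⊆⇒⊆ˢ λ a b p → ∧-intro (D⊆A a b p) (D⊆C a b p)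

    ρ-submodular : ∀ A A′ → ρ (A ∪ A′) + ρ (A ∩ A′) ≤ ρ A + ρ A′
    ρ-submodular A A′ = R3 _ _ (edges⊆E A) (edges⊆E A′)

  ⋃ : ∀ {k} → (Fin k → EdgeSubset) → EdgeSubset
  ⋃ {zero}  F = ∅
  ⋃ {suc k} F = F F.zero ∪ ⋃ (λ i → F (F.suc i))

  ⊆ˢ-refl : ∀ {A} → A ⊆ˢ A
  ⊆ˢ-refl = ⊆⇒⊆ˢ λ _ _ p → p

  ⊆ˢ-trans : ∀ {A C D} → A ⊆ˢ C → C ⊆ˢ D → A ⊆ˢ D
  ⊆ˢ-trans (⊆⇒⊆ˢ A⊆C) (⊆⇒⊆ˢ C⊆D) = ⊆⇒⊆ˢ λ a b p → C⊆D a b (A⊆C a b p)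

  ∪-mono : ∀ {A A′ C C′} → A ⊆ˢ A′ → C ⊆ˢ C′ → (A ∪ C) ⊆ˢ (A′ ∪ C′)
  ∪-mono A⊆A′ C⊆C′ = ∪-least (⊆ˢ-trans A⊆A′ ∪-upperˡ) (⊆ˢ-trans C⊆C′ ∪-upperʳ)

  ⊆-⋃ : ∀ {k} (F : Fin k → EdgeSubset) i → F i ⊆ˢ ⋃ F
  ⊆-⋃ F F.zero    = ∪-upperˡ
  ⊆-⋃ F (F.suc i) = ⊆ˢ-trans (⊆-⋃ (λ i → F (F.suc i)) i) ∪-upperʳ

  ρ-mono : ∀ {A A′} → A ⊆ˢ A′ → ρ A ≤ ρ A′
  ρ-mono {A} {A′} (⊆⇒⊆ˢ A⊆A′) = R2 _ _ (edges⊆E A) (edges⊆E A′) A⊆A′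

  ρ-cong : ∀ {A A′} → A ⊆ˢ A′ → A′ ⊆ˢ A → ρ A ≡ ρ A′
  ρ-cong A⊆A′ A′⊆A = ≤-antisym (ρ-mono A⊆A′) (ρ-mono A′⊆A)

  Spans : EdgeSubset → EdgeSubset → Set
  Spans A C = ρ (A ∪ C) ≡ ρ A

  spans-⊆ : ∀ {A C} → C ⊆ˢ A → Spans A C
  spans-⊆ C⊆A = ρ-cong (∪-least ⊆ˢ-refl C⊆A) ∪-upperˡ

  ρ-≡⇒spans : ∀ {A C} → A ⊆ˢ C → ρ A ≡ ρ C → Spans A C
  ρ-≡⇒spans A⊆C ρA≡ρC = trans (ρ-cong (∪-least A⊆C ⊆ˢ-refl) ∪-upperʳ) (sym ρA≡ρC)

  spans⇒ρ-≡ : ∀ {A C} → A ⊆ˢ C → Spans A C → ρ A ≡ ρ C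
  spans⇒ρ-≡ A⊆C A-spans-C = trans (sym A-spans-C) (ρ-cong (∪-least A⊆C ⊆ˢ-refl) ∪-upperʳ)

  -- Submodularity for A ∪ C and A′, whose intersection contains A.
  spans-monoˡ : ∀ {A A′ C} → A ⊆ˢ A′ → Spans A C → Spans A′ C
  spans-monoˡ {A} {A′} {C} A⊆A′ A-spans-C = ≤-antisym upper (ρ-mono ∪-upperˡ)
    where
      open ≤-Reasoning
      P = A ∪ C
      upper : ρ (A′ ∪ C) ≤ ρ A′
      upper = +-cancelʳ-≤ (ρ P) _ _ (begin
        ρ (A′ ∪ C) + ρ P        ≡⟨ cong₂ _+_ (ρ-cong (∪-least ∪-upperʳ (⊆ˢ-trans ∪-upperʳ ∪-upperˡ))
                                                     (∪-least (∪-mono A⊆A′ ⊆ˢ-refl) ∪-upperˡ))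
                                             A-spans-C ⟩
        ρ (P ∪ A′) + ρ A        ≤⟨ +-monoʳ-≤ (ρ (P ∪ A′)) (ρ-mono (∩-greatest ∪-upperˡ A⊆A′)) ⟩
        ρ (P ∪ A′) + ρ (P ∩ A′) ≤⟨ ρ-submodular P A′ ⟩
        ρ P + ρ A′              ≡⟨ +-comm (ρ P) (ρ A′) ⟩
        ρ A′ + ρ P              ∎)

  spans-monoʳ : ∀ {A C C′} → C′ ⊆ˢ C → Spans A C → Spans A C′
  spans-monoʳ C′⊆C A-spans-C = ≤-antisym
    (≤-trans (ρ-mono (∪-mono ⊆ˢ-refl C′⊆C)) (≤-reflexive A-spans-C))
    (ρ-mono ∪-upperˡ)

  spans-∪ : ∀ {A C D} → Spans A C → Spans A D → Spans A (C ∪ D)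
  spans-∪ {A} {C} {D} A-spans-C A-spans-D = begin
    ρ (A ∪ (C ∪ D))  ≡⟨ ρ-cong (∪-least (⊆ˢ-trans ∪-upperˡ ∪-upperˡ) (∪-mono ∪-upperʳ ⊆ˢ-refl))
                               (∪-least (∪-mono ⊆ˢ-refl ∪-upperˡ) (⊆ˢ-trans ∪-upperʳ ∪-upperʳ)) ⟩
    ρ ((A ∪ C) ∪ D)  ≡⟨ spans-monoˡ ∪-upperˡ A-spans-D ⟩
    ρ (A ∪ C)        ≡⟨ A-spans-C ⟩
    ρ A              ∎
    where open ≡-Reasoning

  spans-⋃ : ∀ {A k} (F : Fin k → EdgeSubset) → (∀ i → Spans A (F i)) → Spans A (⋃ F)
  spans-⋃ {k = zero}  F _       = spans-⊆ (⊆⇒⊆ˢ λ _ _ ())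
  spans-⋃ {k = suc k} F A-spans =
    spans-∪ (A-spans F.zero) (spans-⋃ (λ i → F (F.suc i)) (λ i → A-spans (F.suc i)))

  spans-trans : ∀ {A C D} → Spans A C → Spans C D → Spans A D
  spans-trans {A} {C} {D} A-spans-C C-spans-D = ≤-antisym
    (begin
      ρ (A ∪ D)        ≤⟨ ρ-mono (∪-mono ∪-upperˡ ⊆ˢ-refl) ⟩
      ρ ((A ∪ C) ∪ D)  ≡⟨ spans-monoˡ ∪-upperʳ C-spans-D ⟩
      ρ (A ∪ C)        ≡⟨ A-spans-C ⟩
      ρ A              ∎)
    (ρ-mono ∪-upperˡ)
    where open ≤-Reasoning

deleteEdge⊆complete∪complete :
  ∀ {n} (H : Graph n) {U₁ U₂ : Fin n → Bool} {u v : Fin n} → u ≢ v →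
  (∀ a → V H a ≡ true → a ≢ v → U₁ a ≡ true) → (∀ a → V H a ≡ true → a ≢ u → U₂ a ≡ true) →
  E (deleteEdge H u v) ⊆ (E (complete U₁) ∪ₑ E (complete U₂))
deleteEdge⊆complete∪complete H {U₁} {U₂} {u} {v} u≢v H⊆U₁ H⊆U₂ a b p =
  by-cases (a ≟ v) (b ≟ v)
  where
    ab : E H a b ≡ true
    ab = ∧-conicalˡ _ _ p

    ab∉uv : edge u v a b ≡ false
    ab∉uv = not-injective (∧-conicalʳ _ _ p)

    in-U₂ : a ≢ u → b ≢ u → (E (complete U₁) ∪ₑ E (complete U₂)) a b ≡ true
    in-U₂ a≢u b≢u = ∨-introʳ {E (complete U₁) a b}
      (complete-edge U₂ (H⊆U₂ a (E-V H a b ab) a≢u) (H⊆U₂ b (E-Vʳ H ab) b≢u) (E-≢ H ab))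

    by-cases : Dec (a ≡ v) → Dec (b ≡ v) → (E (complete U₁) ∪ₑ E (complete U₂)) a b ≡ true
    by-cases (no a≢v)  (no b≢v)  =
      ∨-introˡ (complete-edge U₁ (H⊆U₁ a (E-V H a b ab) a≢v) (H⊆U₁ b (E-Vʳ H ab) b≢v) (E-≢ H ab))
    by-cases (yes a≡v) (yes b≡v) = ⊥-elim (E-≢ H ab (trans a≡v (sym b≡v)))
    by-cases (yes a≡v) (no _)    = in-U₂
      (λ a≡u → u≢v (trans (sym a≡u) a≡v))
      (λ b≡u → not-¬ (edge-intro {x = u} {v} {a} {b} (inj₂ (a≡v , b≡u))) ab∉uv)
    by-cases (no _)    (yes b≡v) = in-U₂
      (λ a≡u → not-¬ (edge-intro {x = u} {v} {a} {b} (inj₁ (a≡u , b≡v))) ab∉uv)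
      (λ b≡u → u≢v (trans (sym b≡u) b≡v))

private
  both-or-crossing : ∀ {a₁ a₂ b₁ b₂} → a₁ ∨ a₂ ≡ true → b₁ ∨ b₂ ≡ true →
                     (a₁ ≡ true × b₁ ≡ true) ⊎ (a₂ ≡ true × b₂ ≡ true) ⊎
                     (a₁ ≡ true × a₂ ≡ false × b₂ ≡ true × b₁ ≡ false) ⊎
                     (b₁ ≡ true × b₂ ≡ false × a₂ ≡ true × a₁ ≡ false)
  both-or-crossing {true}  {_}     {true}  {_}     _ _  = inj₁ (refl , refl)
  both-or-crossing {_}     {true}  {_}     {true}  _ _  = inj₂ (inj₁ (refl , refl))
  both-or-crossing {true}  {false} {false} {true}  _ _  = inj₂ (inj₂ (inj₁ (refl , refl , refl , refl)))
  both-or-crossing {false} {true}  {true}  {false} _ _  = inj₂ (inj₂ (inj₂ (refl , refl , refl , refl)))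
  both-or-crossing {true}  {true}  {false} {false} _ ()
  both-or-crossing {true}  {false} {false} {false} _ ()
  both-or-crossing {false} {true}  {false} {false} _ ()
  both-or-crossing {false} {false} {_}     {_}     () _

module Gluing (M : GraphMatroidFamily) {n} (G₁ G₂ : Graph n) where

  V₁ V₂ W : Fin n → Bool
  V₁ = V G₁
  V₂ = V G₂
  W  = V (G₁ ∪G G₂)

  B : Graph n
  B = complete W

  open Spanning (matroid M B)

  edgesᴮ : (H : Graph n) → H ≤G B → EdgeSubset
  edgesᴮ H H≤B = subset (E H) (proj₂ H≤B , E-sym H)

  ρ-edgesᴮ : ∀ H (H≤B : H ≤G B) → ρ (edgesᴮ H H≤B) ≡ rank M H
  ρ-edgesᴮ H H≤B = sym (restrict M B H H≤B (E H) (E-⊆E H))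

  K₁≤B : complete V₁ ≤G B
  K₁≤B = ≤G-complete (complete V₁) λ _ → ∨-introˡ

  K₂≤B : complete V₂ ≤G B
  K₂≤B = ≤G-complete (complete V₂) λ a → ∨-introʳ {V₁ a}

  Eᴮ K₁ K₂ : EdgeSubset
  Eᴮ = edgesᴮ B (≤G-refl {G = B})
  K₁ = edgesᴮ (complete V₁) K₁≤B
  K₂ = edgesᴮ (complete V₂) K₂≤B

  rigid⇒spans-complete : ∀ (H : Graph n) (H≤B : H ≤G B) (K≤B : complete (V H) ≤G B) → Rigid M H →
                         Spans (edgesᴮ H H≤B) (edgesᴮ (complete (V H)) K≤B)
  rigid⇒spans-complete H H≤B K≤B rigid = ρ-≡⇒spans
    (⊆⇒⊆ˢ λ a b ab → complete-edge (V H) (E-V H a b ab) (E-Vʳ H ab) (E-≢ H ab))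
    (trans (ρ-edgesᴮ H H≤B) (trans rigid (sym (ρ-edgesᴮ _ K≤B))))

  edgeᴮ : Fin n → Fin n → EdgeSubset
  edgeᴮ i j = subset (E B ∩ₑ edge i j)
    ( (λ a b p → ∧-conicalˡ _ _ p)
    , λ a b → cong₂ _∧_ (E-sym B a b)
                        (⇔→≡ (mk⇔ (edge-flip {x = i} {j} {a} {b}) (edge-flip {x = i} {j} {b} {a}))))

  edgeᴮ⇒E : ∀ {i j a b} → edges (edgeᴮ i j) a b ≡ true → E B i j ≡ true
  edgeᴮ⇒E {i} {j} {a} {b} p with edge-elim {x = i} {j} {a} {b} (∧-conicalʳ _ _ p)
  ... | inj₁ (refl , refl) = ∧-conicalˡ _ _ p
  ... | inj₂ (refl , refl) = trans (E-sym B i j) (∧-conicalˡ _ _ p)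

  edgeᴮ-comm : ∀ {i j} → edgeᴮ i j ⊆ˢ edgeᴮ j i
  edgeᴮ-comm {i} {j} = ⊆⇒⊆ˢ λ a b p →
    ∧-intro (∧-conicalˡ _ _ p) (edge-swap {x = i} {j} {a} {b} (∧-conicalʳ _ _ p))

  edgeᴮ⊆complete : ∀ {i j} (U : Fin n → Bool) (K≤B : complete U ≤G B) →
                   U i ≡ true → U j ≡ true → edgeᴮ i j ⊆ˢ edgesᴮ (complete U) K≤B
  edgeᴮ⊆complete {i} {j} U _ Ui Uj = ⊆⇒⊆ˢ λ a b p →
    in-U a b (∧-conicalˡ _ _ p) (edge-elim {x = i} {j} {a} {b} (∧-conicalʳ _ _ p))
    where
      in-U : ∀ a b → E B a b ≡ true → (a ≡ i × b ≡ j) ⊎ (a ≡ j × b ≡ i) → E (complete U) a b ≡ true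
      in-U a b ab (inj₁ (refl , refl)) = complete-edge U Ui Uj (E-≢ B ab)
      in-U a b ab (inj₂ (refl , refl)) = complete-edge U Uj Ui (E-≢ B ab)

  Eᴮ⊆⋃edgeᴮ : Eᴮ ⊆ˢ ⋃ (λ i → ⋃ (λ j → edgeᴮ i j))
  Eᴮ⊆⋃edgeᴮ = ⊆⇒⊆ˢ λ a b ab →
    ⊆ˢ⇒⊆ (⊆ˢ-trans (⊆-⋃ (λ j → edgeᴮ a j) b) (⊆-⋃ (λ i → ⋃ (λ j → edgeᴮ i j)) a)) a b
         (∧-intro ab (edge-intro {x = a} {b} {a} {b} (inj₁ (refl , refl))))

  module _ {m} (C : Graph m) (circuit : Circuit M C) (small : ∣V∣ C ≤ 2 + commonVertices G₁ G₂) where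

    module CircuitCopy {u v} (u₁ : V₁ u ≡ true) (u₂ : V₂ u ≡ false)
                             (v₂ : V₂ v ≡ true) (v₁ : V₁ v ≡ false) where

      private
        xy-edge = circuit-edge M circuit
        x  = proj₁ xy-edge
        y  = proj₁ (proj₂ xy-edge)
        xy = proj₂ (proj₂ xy-edge)

        u≢v : u ≢ v
        u≢v refl = not-¬ u₁ v₁

        emb : Embedding C x y u v (λ a → V₁ a ∧ V₂ a)
        emb = embedding C (E-V C x y xy) (E-Vʳ C xy) (E-≢ C xy) u≢v
                        (cong₂ _∧_ u₁ u₂) (cong (_∧ V₂ v) v₁) small
        open Embedding emb

        H≅ = imageGraph-≅ C φ φ-inj

      H H′ : Graph n
      H  = imageGraph C φ φ-inj
      H′ = deleteEdge H u v

      H-V₁ : ∀ a → V H a ≡ true → a ≢ v → V₁ a ≡ true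
      H-V₁ a Va a≢v with c , Vc , refl ← image-vertex-elim C φ φ-inj Va with c ≟ x
      ... | yes refl = subst (λ a → V₁ a ≡ true) (sym φ-x) u₁
      ... | no c≢x   = ∧-conicalˡ _ _ (φ-T c Vc c≢x λ { refl → a≢v φ-y })

      H-V₂ : ∀ a → V H a ≡ true → a ≢ u → V₂ a ≡ true
      H-V₂ a Va a≢u with c , Vc , refl ← image-vertex-elim C φ φ-inj Va with c ≟ y
      ... | yes refl = subst (λ a → V₂ a ≡ true) (sym φ-y) v₂
      ... | no c≢y   = ∧-conicalʳ _ _ (φ-T c Vc (λ { refl → a≢u φ-x }) c≢y)

      H-W : ∀ a → V H a ≡ true → W a ≡ true
      H-W a Va with a ≟ v
      ... | yes refl = ∨-introʳ {V₁ v} v₂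
      ... | no a≢v   = ∨-introˡ (H-V₁ a Va a≢v)

      H≤B : H ≤G B
      H≤B = ≤G-complete H H-W

      H′≤B : H′ ≤G B
      H′≤B = ≤G-complete H′ H-W

      H′⊆H : edgesᴮ H′ H′≤B ⊆ˢ edgesᴮ H H≤B
      H′⊆H = ⊆⇒⊆ˢ (proj₂ (deleteEdge-≤G H u v))

      H′⊆K₁∪K₂ : edgesᴮ H′ H′≤B ⊆ˢ (K₁ ∪ K₂)
      H′⊆K₁∪K₂ = ⊆ˢ-∪ (deleteEdge⊆complete∪complete H u≢v H-V₁ H-V₂)

      uv∈H : E H u v ≡ true
      uv∈H = subst₂ (λ a b → E H a b ≡ true) φ-x φ-y (image-edge-intro C φ φ-inj xy)

      edgeᴮ⊆H : edgeᴮ u v ⊆ˢ edgesᴮ H H≤B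
      edgeᴮ⊆H = ⊆⇒⊆ˢ λ a b p → in-H a b (edge-elim {x = u} {v} {a} {b} (∧-conicalʳ _ _ p))
        where
          in-H : ∀ a b → (a ≡ u × b ≡ v) ⊎ (a ≡ v × b ≡ u) → E H a b ≡ true
          in-H a b (inj₁ (refl , refl)) = uv∈H
          in-H a b (inj₂ (refl , refl)) = trans (E-sym H v u) uv∈H

      ρH′≡ρH : ρ (edgesᴮ H′ H′≤B) ≡ ρ (edgesᴮ H H≤B)
      ρH′≡ρH = begin
        ρ (edgesᴮ H′ H′≤B)             ≡⟨ ρ-edgesᴮ H′ H′≤B ⟩
        rank M H′                      ≡⟨ restrict M H H′ (deleteEdge-≤G H u v) (E H′) (E-⊆E H′) ⟩
        rk M H (E H′)                  ≡⟨ subst₂ (λ a b → rk M H (E (deleteEdge H a b)) ≡ rk M C (E C′))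
                                                 φ-x φ-y (rank-deleteEdge-≅ M H≅ (E-V C x y xy) (E-Vʳ C xy)) ⟩
        rk M C (E C′)                  ≡⟨ circuit-rank-deleteEdge M circuit xy ⟩
        rank M C                       ≡⟨ sym (rank-≅ M H≅) ⟩
        rank M H                       ≡⟨ sym (ρ-edgesᴮ H H≤B) ⟩
        ρ (edgesᴮ H H≤B)               ∎
        where
          open ≡-Reasoning
          C′ = deleteEdge C x y

    crossing-edgeᴮ-spanned : ∀ {u v} → V₁ u ≡ true → V₂ u ≡ false → V₂ v ≡ true → V₁ v ≡ false →
                             Spans (K₁ ∪ K₂) (edgeᴮ u v)
    crossing-edgeᴮ-spanned u₁ u₂ v₂ v₁ =
      spans-monoʳ edgeᴮ⊆H (spans-monoˡ H′⊆K₁∪K₂ (ρ-≡⇒spans H′⊆H ρH′≡ρH))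
      where open CircuitCopy u₁ u₂ v₂ v₁

    edgeᴮ-spanned : ∀ i j → Spans (K₁ ∪ K₂) (edgeᴮ i j)
    edgeᴮ-spanned i j with E B i j in ij
    ... | false = spans-⊆ (⊆⇒⊆ˢ λ a b p → ⊥-elim (not-¬ (edgeᴮ⇒E {i} {j} {a} {b} p) ij))
    ... | true  with both-or-crossing {V₁ i} {V₂ i} {V₁ j} {V₂ j} (E-V B i j ij) (E-Vʳ B ij)
    ...   | inj₁ (i₁ , j₁)         = spans-⊆ (⊆ˢ-trans (edgeᴮ⊆complete V₁ K₁≤B i₁ j₁) ∪-upperˡ)
    ...   | inj₂ (inj₁ (i₂ , j₂))  = spans-⊆ (⊆ˢ-trans (edgeᴮ⊆complete V₂ K₂≤B i₂ j₂) ∪-upperʳ)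
    ...   | inj₂ (inj₂ (inj₁ (i₁ , i₂ , j₂ , j₁))) = crossing-edgeᴮ-spanned i₁ i₂ j₂ j₁
    ...   | inj₂ (inj₂ (inj₂ (j₁ , j₂ , i₂ , i₁))) =
      spans-monoʳ edgeᴮ-comm (crossing-edgeᴮ-spanned j₁ j₂ i₂ i₁)

    K₁∪K₂-spans-Eᴮ : Spans (K₁ ∪ K₂) Eᴮ
    K₁∪K₂-spans-Eᴮ = spans-monoʳ Eᴮ⊆⋃edgeᴮ (spans-⋃ _ λ i → spans-⋃ _ λ j → edgeᴮ-spanned i j)

    rigid-∪ : Rigid M G₁ → Rigid M G₂ → Rigid M (G₁ ∪G G₂)
    rigid-∪ rigid₁ rigid₂ = begin
      rank M (G₁ ∪G G₂)  ≡⟨ sym (ρ-edgesᴮ (G₁ ∪G G₂) G≤B) ⟩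
      ρ G                ≡⟨ spans⇒ρ-≡ (⊆⇒⊆ˢ (proj₂ G≤B)) (spans-trans G-spans-K₁∪K₂ K₁∪K₂-spans-Eᴮ) ⟩
      ρ Eᴮ               ≡⟨ ρ-edgesᴮ B (≤G-refl {G = B}) ⟩
      rank M B           ∎
      where
        open ≡-Reasoning
        G≤B = ≤G-complete (G₁ ∪G G₂) λ _ p → p
        G   = edgesᴮ (G₁ ∪G G₂) G≤B
        G-spans-K₁∪K₂ : Spans G (K₁ ∪ K₂)
        G-spans-K₁∪K₂ = spans-∪
          (spans-monoˡ (⊆⇒⊆ˢ λ _ _ → ∨-introˡ)
                       (rigid⇒spans-complete G₁ (≤G-complete G₁ λ _ → ∨-introˡ) K₁≤B rigid₁))
          (spans-monoˡ (⊆⇒⊆ˢ λ a b → ∨-introʳ {E G₁ a b})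
                       (rigid⇒spans-complete G₂ (≤G-complete G₂ λ a → ∨-introʳ {V₁ a}) K₂≤B rigid₂))

lemma2p3 : (M : GraphMatroidFamily) → Nontrivial M →
           (d t : ℕ) → IsDimensionality M d → IsThreshold M d t →
           ∀ {n} (G₁ G₂ : Graph n) → t ≤ commonVertices G₁ G₂ →
           Rigid M G₁ → Rigid M G₂ → Rigid M (G₁ ∪G G₂)
lemma2p3 M _ d t _ ((_ , C , circuit , _ , t≡∣V∣-1) , _) G₁ G₂ t≤common =
  Gluing.rigid-∪ M G₁ G₂ C circuit small
  where
    open ≤-Reasoning
    small : ∣V∣ C ≤ 2 + commonVertices G₁ G₂
    small = begin
      ∣V∣ C                         ≤⟨ m≤n+m∸n (∣V∣ C) 1 ⟩
      1 + (∣V∣ C ∸ 1)               ≡⟨ cong suc (sym t≡∣V∣-1) ⟩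
      1 + t                         ≤⟨ s≤s t≤common ⟩
      1 + commonVertices G₁ G₂      ≤⟨ n≤1+n _ ⟩
      2 + commonVertices G₁ G₂      ∎
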